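{- Let $t$ be a $\lambda$-term and let $\vec{x} = (x_1, \dots, x_k)$ be a list of pairwise distinct variables with $\mathrm{fv}(t) \subseteq \{x_1,\dots,x_k\}$. The following are equivalent: (1) $t$ is normalizable for balanced shuffling reduction $\to_{\bar{\mathsf{sh}}}$; (2) $t \simeq_{\mathsf{sh}} u$ for some term $u$ that is $\bar{\mathsf{sh}}$-normal; (3) $[\![ t ]\!]_{\vec{x}} \neq \emptyset$; (4) there is a type derivation with conclusion $x_1 \colon P_1, \dots, x_k \colon P_k \vdash t \colon Q$ for some positive types $P_1, \dots, P_k, Q$; (5) $t$ is strongly normalizable for $\to_{\bar{\mathsf{sh}}}$.
   Context: Terms: $t,u,s ::= x \mid \lambda x.t \mid tu$, considered up to $\alpha$-conversion; $\mathrm{fv}(t)$ is the set of free variables. Values are variables and abstractions. $t\{v/x\}$ is capture-avoiding substitution. Balanced contexts: $B ::= [\cdot] \mid (\lambda x.B)t \mid Bt \mid tB$; general contexts: $C ::= [\cdot] \mid \lambda x.C \mid Ct \mid tC$. Root rules: $(\lambda x.t)v \mapsto_{\beta_v} t\{v/x\}$ for $v$ a value; $(\lambda x.t)us \mapsto_{\sigma_1} (\lambda x.ts)u$ if $x \notin \mathrm{fv}(s)$; $v((\lambda x.s)u) \mapsto_{\sigma_3} (\lambda x.vs)u$ if $v$ is a value and $x \notin \mathrm{fv}(v)$; $\mapsto_\sigma = \mapsto_{\sigma_1}\cup\mapsto_{\sigma_3}$, $\mapsto_{\mathsf{sh}} = \mapsto_{\beta_v} \cup \mapsto_\sigma$.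 For $r$ among these, $\to_r$ is the closure of $\mapsto_r$ under all contexts $C$, and the balanced reduction $\to_{\bar r}$ is its closure under balanced contexts $B$. $\simeq_{\mathsf{sh}}$ is the reflexive, symmetric, transitive closure of $\to_{\mathsf{sh}}$. A term is $r$-normal if it has no $\to_r$-step, $r$-normalizable if it reduces in finitely many steps to an $r$-normal term, strongly $r$-normalizable if there is no infinite $\to_r$-sequence from it. Types: negative types $N ::= P \multimap Q$; positive types $P,Q ::= [N_1,\dots,N_n]$ finite multisets of negative types ($n\ge 0$); $\mathbf{0}$ is the empty multiset. An environment $\Gamma$ is a map from variables to positive types with $\Gamma(x) = \mathbf{0}$ for all but finitely many $x$; $\Gamma \uplus \Delta$ is pointwise multiset sum; $x_1\colon P_1,\dots,x_k\colon P_k$ denotes the environment mapping $x_i$ to $P_i$ and every other variable to $\mathbf{0}$. Typing rules: (ax) $x \colon P \vdash x \colon P$; (@) from $\Gamma \vdash t \colon [P \multimap Q]$ and $\Gamma' \vdash u \colon P$ infer $\Gamma \uplus \Gamma' \vdash tu \colon Q$; ($\lambda$) for any $n \ge 0$, from $\Gamma_i, x\colon P_i \vdash t \colon Q_i$ ($1\le i\le n$, with $\Gamma_i(x)=\mathbf{0}$) infer $\Gamma_1\uplus\dots\uplus\Gamma_n \vdash \lambda x.t \colon [P_1\multimap Q_1,\dots,P_n\multimap Q_n]$. Semantics: for $\vec{x}=(x_1,\dots,x_k)$ pairwise distinct with $\mathrm{fv}(t)\subseteq\{x_1,\dots,x_k\}$, $[\![t]\!]_{\vec{x}} = \{((P_1,\dots,P_k),Q)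 \mid \text{there is a derivation of } x_1\colon P_1,\dots,x_k\colon P_k \vdash t \colon Q\}$. -}

module Defs where

open import Data.Nat using (ℕ; zero; suc)
open import Data.Fin using (Fin; zero; suc)
open import Data.List using (List; []; _∷_; _++_)
open import Data.List.Relation.Binary.Permutation.Propositional using (_↭_)
open import Data.List.Relation.Binary.Pointwise using (Pointwise)
open import Data.Vec using (Vec; []; _∷_)
import Data.Vec as Vec
open import Data.Product using (Σ; ∃; _×_; _,_)
open import Relation.Nullary using (¬_)
open import Relation.Unary using (Pred)
open import Relation.Binary.Construct.Closure.ReflexiveTransitive using (Star)
open import Relation.Binary.Construct.Closure.Equivalence using (EqClosure)
open import Induction.WellFounded using (Acc)

-- Terms up to α-conversion: well-scoped de Bruijn terms.
-- Tm k = λ-terms whose free variables are among the k distinct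
-- variables x₁,…,xₖ (free variable xᵢ is  var i).

data Tm (n : ℕ) : Set where
  var : Fin n → Tm n
  lam : Tm (suc n) → Tm n
  app : Tm n → Tm n → Tm n

data Value {n : ℕ} : Tm n → Set where
  var : (i : Fin n) → Value (var i)
  lam : (t : Tm (suc n)) → Value (lam t)

ext : {n m : ℕ} → (Fin n → Fin m) → Fin (suc n) → Fin (suc m)
ext ρ zero    = zero
ext ρ (suc i) = suc (ρ i)

rename : {n m : ℕ} → (Fin n → Fin m) → Tm n → Tm m
rename ρ (var i)   = var (ρ i)
rename ρ (lam t)   = lam (rename (ext ρ) t)
rename ρ (app t u) = app (rename ρ t) (rename ρ u)

weaken : {n : ℕ} → Tm n → Tm (suc n)
weaken = rename suc

exts : {n m : ℕ} → (Fin n → Tm m) → Fin (suc n) → Tm (suc m)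
exts σ zero    = var zero
exts σ (suc i) = weaken (σ i)

subst : {n m : ℕ} → (Fin n → Tm m) → Tm n → Tm m
subst σ (var i)   = σ i
subst σ (lam t)   = lam (subst (exts σ) t)
subst σ (app t u) = app (subst σ t) (subst σ u)

-- t{v/x} where x is the variable bound by the outermost binder (index 0)
_[_] : {n : ℕ} → Tm (suc n) → Tm n → Tm n
t [ v ] = subst σ t
  where
    σ : Fin (suc _) → Tm _
    σ zero    = v
    σ (suc i) = var i

data _↦βv_ {n : ℕ} : Tm n → Tm n → Set where
  βv : (t : Tm (suc n)) (v : Tm n) → Value v → app (lam t) v ↦βv (t [ v ])

-- σ₁ : (λx.t)us ↦ (λx.ts)u   (x ∉ fv(s) is enforced by weakening s)
-- σ₃ : v((λx.s)u) ↦ (λx.vs)u (x ∉ fv(v) is enforced by weakening v)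
data _↦σ_ {n : ℕ} : Tm n → Tm n → Set where
  σ₁ : (t : Tm (suc n)) (u s : Tm n) →
       app (app (lam t) u) s ↦σ app (lam (app t (weaken s))) u
  σ₃ : (v : Tm n) (s : Tm (suc n)) (u : Tm n) → Value v →
       app v (app (lam s) u) ↦σ app (lam (app (weaken v) s)) u

data _↦sh_ {n : ℕ} : Tm n → Tm n → Set where
  βv : {t u : Tm n} → t ↦βv u → t ↦sh u
  σ  : {t u : Tm n} → t ↦σ u → t ↦sh u

data _→sh_ : {n : ℕ} → Tm n → Tm n → Set where
  root : {n : ℕ} {t u : Tm n} → t ↦sh u → t →sh u
  lam  : {n : ℕ} {t t' : Tm (suc n)} → t →sh t' → lam t →sh lam t'
  appL : {n : ℕ} {t t' s : Tm n} → t →sh t' → app t s →sh app t' s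
  appR : {n : ℕ} {t s s' : Tm n} → s →sh s' → app t s →sh app t s'

-- closure under balanced contexts B ::= [·] | (λx.B)t | Bt | tB
data _→bsh_ : {n : ℕ} → Tm n → Tm n → Set where
  root   : {n : ℕ} {t u : Tm n} → t ↦sh u → t →bsh u
  lamApp : {n : ℕ} {t t' : Tm (suc n)} {s : Tm n} →
           t →bsh t' → app (lam t) s →bsh app (lam t') s
  appL   : {n : ℕ} {t t' s : Tm n} → t →bsh t' → app t s →bsh app t' s
  appR   : {n : ℕ} {t s s' : Tm n} → s →bsh s' → app t s →bsh app t s'

_≃sh_ : {n : ℕ} → Tm n → Tm n → Set
_≃sh_ = EqClosure _→sh_

BshNormal : {n : ℕ} → Tm n → Set
BshNormal t = ∀ u → ¬ (t →bsh u)

BshNormalizable : {n : ℕ} → Tm n → Set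
BshNormalizable t = ∃ λ u → Star _→bsh_ t u × BshNormal u

BshSN : {n : ℕ} → Tm n → Set
BshSN = Acc (λ u t → t →bsh u)

-- Types.  Positive types are finite multisets of negative types,
-- represented by lists and identified up to (deep) permutation ≈P.

data Neg : Set where
  _⊸_ : List Neg → List Neg → Neg

Pos : Set
Pos = List Neg

𝟎 : Pos
𝟎 = []

mutual
  data _≈N_ : Neg → Neg → Set where
    ⊸-cong : {P P' Q Q' : Pos} → P ≈P P' → Q ≈P Q' → (P ⊸ Q) ≈N (P' ⊸ Q')

  data _≈P_ : Pos → Pos → Set where
    perm : {P L P' : Pos} → P ↭ L → Pointwise _≈N_ L P' → P ≈P P'

-- environments for the fixed variables x₁,…,xₖ: Γ(xᵢ) = lookup Γ i
Env : ℕ → Set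
Env k = Vec Pos k

_≈E_ : {k : ℕ} → Env k → Env k → Set
Γ ≈E Δ = ∀ i → Vec.lookup Γ i ≈P Vec.lookup Δ i

_⊕_ : {k : ℕ} → Env k → Env k → Env k
_⊕_ = Vec.zipWith _++_

∅E : {k : ℕ} → Env k
∅E = Vec.replicate _ 𝟎

single : {k : ℕ} → Fin k → Pos → Env k
single i P = Vec.updateAt ∅E i (λ _ → P)

-- typing judgement  Γ ⊢ t ∶ Q; the rule  conv  expresses that
-- environments and types are considered up to multiset equality.
mutual
  data _⊢_∶_ {k : ℕ} : Env k → Tm k → Pos → Set where
    ax   : (i : Fin k) (P : Pos) → single i P ⊢ var i ∶ P
    app  : {Γ Γ' : Env k} {t u : Tm k} {P Q : Pos} →
           Γ ⊢ t ∶ ((P ⊸ Q) ∷ []) → Γ' ⊢ u ∶ P → (Γ ⊕ Γ') ⊢ app t u ∶ Q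
    lam  : {Γ : Env k} {t : Tm (suc k)} {A : Pos} →
           LamPremises Γ t A → Γ ⊢ lam t ∶ A
    conv : {Γ Γ' : Env k} {t : Tm k} {P P' : Pos} →
           Γ ⊢ t ∶ P → Γ ≈E Γ' → P ≈P P' → Γ' ⊢ t ∶ P'

  -- the n ≥ 0 premises  Γᵢ, x : Pᵢ ⊢ t ∶ Qᵢ  of the (λ) rule, giving
  -- Γ₁ ⊎ … ⊎ Γₙ  and the type  [P₁ ⊸ Q₁, …, Pₙ ⊸ Qₙ]
  -- (the bound variable x is de Bruijn index 0, so Γᵢ(x) = 𝟎 is automatic)
  data LamPremises {k : ℕ} : Env k → Tm (suc k) → Pos → Set where
    []  : {t : Tm (suc k)} → LamPremises ∅E t []
    _∷_ : {Γ Δ : Env k} {t : Tm (suc k)} {P Q A : Pos} →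
          (P ∷ Γ) ⊢ t ∶ Q → LamPremises Δ t A →
          LamPremises (Γ ⊕ Δ) t ((P ⊸ Q) ∷ A)

⟦_⟧ : {k : ℕ} → Tm k → Pred (Env k × Pos) _
⟦ t ⟧ (Γ , Q) = Γ ⊢ t ∶ Q

-- Typing is done in a sized variant of the non-idempotent multi type system, the size of a
-- derivation being its number of application rules. Typability is invariant under ≃sh: the
-- key facts are that substituting a value is size-additive and can be undone, because the
-- typings of a value split along any decomposition of its type. A βv-step strictly lowers
-- the size, while a σ-step keeps it and lowers a measure μ of the term, so typable terms are
-- strongly normalising for balanced reduction by lexicographic induction. Conversely every
-- balanced normal form is typable, so a term ≃sh-equivalent to a normal form is typable,
-- hence strongly normalising, hence normalising by progress. Typability in the sized system
-- is equivalent to derivability in _⊢_∶_.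

module Submission where

open import Algebra.Bundles using (CommutativeMonoid)
import Algebra.Construct.Pointwise as PointwiseAlgebra
import Algebra.Properties.CommutativeMonoid.Sum as MonoidSum
import Algebra.Solver.CommutativeMonoid as CommutativeMonoidSolver
open import Data.Empty using (⊥; ⊥-elim)
open import Data.Fin using (Fin; zero; suc)
open import Data.List using (List; []; _∷_; _++_)
open import Data.List.Properties using (++-assoc; ++-identityʳ)
open import Data.List.Relation.Binary.Permutation.Propositional as ↭ using (_↭_)
open import Data.List.Relation.Binary.Permutation.Propositional.Properties using (++⁺ˡ; ++⁺ʳ; ++-comm)
open import Data.List.Relation.Binary.Pointwise as Pw using (Pointwise; []; _∷_)
open import Data.Nat using (ℕ; zero; suc; _+_; _*_; _<_; z<s; s<s)
open import Data.Nat.Induction using (<-wellFounded)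
open import Data.Nat.Properties
  using (+-identityʳ; +-assoc; +-suc; +-monoˡ-<; +-monoʳ-<; m<n+m; n<1+n; +-commutativeSemigroup)
open import Algebra.Properties.CommutativeSemigroup +-commutativeSemigroup
  using (x∙yz≈y∙xz; xy∙z≈xz∙y; interchange)
open import Data.Nat.Tactic.RingSolver using (solve-∀)
open import Data.Product using (Σ; ∃; ∃-syntax; _×_; _,_)
open import Data.Product.Relation.Binary.Lex.Strict using (×-Lex; ×-wellFounded)
open import Data.Sum using (_⊎_; inj₁; inj₂)
open import Data.Unit using (⊤; tt)
open import Data.Vec using (Vec; []; _∷_)
open import Data.Vec.Functional using (tail)
import Data.Vec as Vec
import Data.Vec.Properties as Vecₚ
open import Function using (_∘_; case_of_)
open import Function.Bundles using (_⇔_; mk⇔)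
open import Induction.WellFounded using (Acc; acc)
open import Level using (0ℓ)
open import Relation.Binary.Construct.Closure.ReflexiveTransitive as Star using (Star; ε; _◅_; _◅◅_)
open import Relation.Binary.Construct.Closure.Symmetric using (fwd; bwd)
open import Relation.Binary.PropositionalEquality as ≡ using (_≡_; refl)
open import Relation.Nullary using (¬_)
open import Relation.Unary using (Satisfiable)

open import Defs

variable
  a b k n m : ℕ
  P P' Q Q' A A' B B' : Pos
  t t' u u' v : Tm _
  θ : Fin a → Tm b

-- Multiset equality of types

-- As a reflexive-transitive closure _~_ is an equivalence for free: only single ≈P-steps
-- have to be reversed.
infix 4 _~_

_~_ : Pos → Pos → Set
_~_ = Star _≈P_

mutual
  ≈N-refl : ∀ N → N ≈N N
  ≈N-refl (P ⊸ Q) = ⊸-cong (≈P-refl P) (≈P-refl Q)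

  ≈P-refl : ∀ P → P ≈P P
  ≈P-refl P = perm ↭.refl (≈Pw-refl P)

  ≈Pw-refl : ∀ P → Pointwise _≈N_ P P
  ≈Pw-refl []      = []
  ≈Pw-refl (N ∷ P) = ≈N-refl N ∷ ≈Pw-refl P

↭⇒~ : P ↭ Q → P ~ Q
↭⇒~ p = perm p (≈Pw-refl _) ◅ ε

≡⇒~ : P ≡ Q → P ~ Q
≡⇒~ refl = ε

⊸-cong~ : P ~ P' → Q ~ Q' → Star _≈N_ (P ⊸ Q) (P' ⊸ Q')
⊸-cong~ {P' = P'} {Q = Q} p q =
  Star.gmap (_⊸ Q) (λ s → ⊸-cong s (≈P-refl Q)) p ◅◅
  Star.gmap (P' ⊸_) (λ s → ⊸-cong (≈P-refl P') s) q

∷-cong~ : {N N' : Neg} → Star _≈N_ N N' → P ~ P' → (N ∷ P) ~ (N' ∷ P')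
∷-cong~ {P = P} {N' = N'} n p =
  Star.gmap (_∷ P) (λ s → perm ↭.refl (s ∷ ≈Pw-refl P)) n ◅◅
  Star.gmap (N' ∷_) (λ { (perm q pw) → perm (↭.prep N' q) (≈N-refl N' ∷ pw) }) p

mutual
  ≈N-sym : {N N' : Neg} → N ≈N N' → Star _≈N_ N' N
  ≈N-sym (⊸-cong p q) = ⊸-cong~ (≈P-sym p) (≈P-sym q)

  ≈P-sym : P ≈P P' → P' ~ P
  ≈P-sym (perm p pw) = ≈Pw-sym pw ◅◅ ↭⇒~ (↭.↭-sym p)

  ≈Pw-sym : Pointwise _≈N_ P P' → P' ~ P
  ≈Pw-sym []       = ε
  ≈Pw-sym (n ∷ pw) = ∷-cong~ (≈N-sym n) (≈Pw-sym pw)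

~-sym : P ~ Q → Q ~ P
~-sym ε       = ε
~-sym (s ◅ p) = ~-sym p ◅◅ ≈P-sym s

++-cong : A ~ A' → B ~ B' → (A ++ B) ~ (A' ++ B')
++-cong {A' = A'} {B = B} p q =
  Star.gmap (_++ B) (λ { (perm r pw) → perm (++⁺ʳ B r) (Pw.++⁺ pw (≈Pw-refl B)) }) p ◅◅
  Star.gmap (A' ++_) (λ { (perm r pw) → perm (++⁺ˡ A' r) (Pw.++⁺ (≈Pw-refl A') pw) }) q

Pos-commutativeMonoid : CommutativeMonoid 0ℓ 0ℓ
Pos-commutativeMonoid = record
  { Carrier = Pos
  ; _≈_ = _~_
  ; _∙_ = _++_
  ; ε = []
  ; isCommutativeMonoid = record
    { isMonoid = record
      { isSemigroup = record
        { isMagma = record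
          { isEquivalence = record { refl = ε ; sym = ~-sym ; trans = _◅◅_ }
          ; ∙-cong = ++-cong
          }
        ; assoc = λ A B C → ≡⇒~ (++-assoc A B C)
        }
      ; identity = (λ A → ε) , (λ A → ≡⇒~ (++-identityʳ A))
      }
    ; comm = λ A B → ↭⇒~ (++-comm A B)
    }
  }

-- Environments

Ctx : ℕ → Set
Ctx k = Fin k → Pos

variable
  Γ Γ' Γ₁ Γ₂ Δ Δ' Δ₁ Δ₂ : Ctx _

infix 4 _~E_
infixr 6 _⊞_
infixr 5 _∷ᶜ_
infix 7 _↦_

_~E_ : Ctx k → Ctx k → Set
Γ ~E Δ = ∀ i → Γ i ~ Δ i

_⊞_ : Ctx k → Ctx k → Ctx k
(Γ ⊞ Δ) i = Γ i ++ Δ i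

∅ : Ctx k
∅ _ = []

Ctx-commutativeMonoid : ℕ → CommutativeMonoid 0ℓ 0ℓ
Ctx-commutativeMonoid k = record
  { _≈_ = _~E_
  ; _∙_ = _⊞_
  ; ε = ∅
  ; isCommutativeMonoid =
      PointwiseAlgebra.isCommutativeMonoid (Fin k)
        (CommutativeMonoid.isCommutativeMonoid Pos-commutativeMonoid)
  }

_∷ᶜ_ : Pos → Ctx k → Ctx (suc k)
(P ∷ᶜ Γ) zero    = P
(P ∷ᶜ Γ) (suc i) = Γ i

_↦_ : Fin k → Pos → Ctx k
(zero  ↦ P) zero    = P
(zero  ↦ P) (suc j) = []
(suc i ↦ P) zero    = []
(suc i ↦ P) (suc j) = (i ↦ P) j

~E-refl : Γ ~E Γ
~E-refl _ = ε

~E-sym : Γ ~E Δ → Δ ~E Γ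
~E-sym e i = ~-sym (e i)

~E-trans : Γ ~E Δ → Δ ~E Γ' → Γ ~E Γ'
~E-trans e f i = e i ◅◅ f i

⊞-cong : Γ ~E Γ' → Δ ~E Δ' → Γ ⊞ Δ ~E Γ' ⊞ Δ'
⊞-cong e f i = ++-cong (e i) (f i)

⊞-congˡ : (Δ : Ctx k) → Γ ~E Γ' → Γ ⊞ Δ ~E Γ' ⊞ Δ
⊞-congˡ Δ e = ⊞-cong e ~E-refl

⊞-congʳ : (Γ : Ctx k) → Δ ~E Δ' → Γ ⊞ Δ ~E Γ ⊞ Δ'
⊞-congʳ Γ f = ⊞-cong ~E-refl f

module _ {k : ℕ} where

  open CommutativeMonoid (Ctx-commutativeMonoid k) public
    using () renaming (comm to ⊞-comm; assoc to ⊞-assoc; identityʳ to ⊞-identityʳ)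

  private
    open module Solver = CommutativeMonoidSolver (Ctx-commutativeMonoid k)
      using (solve; _⊜_) renaming (_⊕_ to _∙_)

  ⊞-rotate : (A B C : Ctx k) → (A ⊞ B) ⊞ C ~E (A ⊞ C) ⊞ B
  ⊞-rotate = solve 3 (λ a b c → (a ∙ b) ∙ c ⊜ (a ∙ c) ∙ b) ~E-refl

  ⊞-swap : (A B C : Ctx k) → A ⊞ (B ⊞ C) ~E B ⊞ (A ⊞ C)
  ⊞-swap = solve 3 (λ a b c → a ∙ (b ∙ c) ⊜ b ∙ (a ∙ c)) ~E-refl

  ⊞-interchange : (A B C D : Ctx k) → (A ⊞ B) ⊞ (C ⊞ D) ~E (A ⊞ C) ⊞ (B ⊞ D)
  ⊞-interchange = solve 4 (λ a b c d → (a ∙ b) ∙ (c ∙ d) ⊜ (a ∙ c) ∙ (b ∙ d)) ~E-refl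

∷ᶜ-cong : P ~ P' → Γ ~E Γ' → P ∷ᶜ Γ ~E P' ∷ᶜ Γ'
∷ᶜ-cong p e zero    = p
∷ᶜ-cong p e (suc i) = e i

∷ᶜ-η : (Γ : Ctx (suc k)) → Γ zero ∷ᶜ tail Γ ~E Γ
∷ᶜ-η Γ zero    = ε
∷ᶜ-η Γ (suc i) = ε

↦-cong : (i : Fin k) → P ~ P' → i ↦ P ~E i ↦ P'
↦-cong zero    p zero    = p
↦-cong zero    p (suc j) = ε
↦-cong (suc i) p zero    = ε
↦-cong (suc i) p (suc j) = ↦-cong i p j

∷ᶜ-⊞ : (P Q : Pos) (Γ Δ : Ctx k) → (P ∷ᶜ Γ) ⊞ (Q ∷ᶜ Δ) ~E (P ++ Q) ∷ᶜ (Γ ⊞ Δ)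
∷ᶜ-⊞ P Q Γ Δ zero    = ε
∷ᶜ-⊞ P Q Γ Δ (suc i) = ε

∷ᶜ-split : (P : Pos) (Γ : Ctx k) → P ∷ᶜ Γ ~E (zero ↦ P) ⊞ ([] ∷ᶜ Γ)
∷ᶜ-split P Γ zero    = ≡⇒~ (≡.sym (++-identityʳ P))
∷ᶜ-split P Γ (suc i) = ε

↦-[] : (i j : Fin k) → (i ↦ []) j ≡ []
↦-[] zero    zero    = refl
↦-[] zero    (suc j) = refl
↦-[] (suc i) zero    = refl
↦-[] (suc i) (suc j) = ↦-[] i j

↦-++ : (i : Fin k) (A B : Pos) → i ↦ (A ++ B) ~E (i ↦ A) ⊞ (i ↦ B)
↦-++ zero    A B zero    = ε
↦-++ zero    A B (suc j) = ε
↦-++ (suc i) A B zero    = ε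
↦-++ (suc i) A B (suc j) = ↦-++ i A B j

-- Sized derivations

-- The rules of _⊢_∶_, except that a derivation records its size (its number of
-- application rules) and multiset conversions are built into every rule instead of forming
-- a separate rule, so that inversion only meets the rule of the head constructor.
-- Γ ⊩Λ⟨ n ⟩ t ∶ A collects the premises of the (λ) rule for λ.t at type A.
infix 4 _⊩⟨_⟩_∶_ _⊩Λ⟨_⟩_∶_

mutual
  data _⊩⟨_⟩_∶_ {k : ℕ} : Ctx k → ℕ → Tm k → Pos → Set where
    ax  : ∀ {Γ} i {P} → Γ ~E i ↦ P → Γ ⊩⟨ 0 ⟩ var i ∶ P
    app : ∀ {Γ Γ₁ Γ₂ t u P Q Q' n₁ n₂} →
          Γ₁ ⊩⟨ n₁ ⟩ t ∶ (P ⊸ Q) ∷ [] → Γ₂ ⊩⟨ n₂ ⟩ u ∶ P → Γ ~E Γ₁ ⊞ Γ₂ → Q ~ Q' →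
          Γ ⊩⟨ suc (n₁ + n₂) ⟩ app t u ∶ Q'
    lam : ∀ {Γ t A A' n} → Γ ⊩Λ⟨ n ⟩ t ∶ A → A ~ A' → Γ ⊩⟨ n ⟩ lam t ∶ A'

  data _⊩Λ⟨_⟩_∶_ {k : ℕ} : Ctx k → ℕ → Tm (suc k) → Pos → Set where
    nil  : ∀ {Γ t} → Γ ~E ∅ → Γ ⊩Λ⟨ 0 ⟩ t ∶ []
    cons : ∀ {Γ Γ₁ Γ₂ t P Q A n m} →
           P ∷ᶜ Γ₁ ⊩⟨ n ⟩ t ∶ Q → Γ₂ ⊩Λ⟨ m ⟩ t ∶ A → Γ ~E Γ₁ ⊞ Γ₂ →
           Γ ⊩Λ⟨ n + m ⟩ t ∶ (P ⊸ Q) ∷ A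

⊩Λ-conv-ctx : Γ' ~E Γ → Γ ⊩Λ⟨ n ⟩ t ∶ A → Γ' ⊩Λ⟨ n ⟩ t ∶ A
⊩Λ-conv-ctx e (nil e')      = nil (~E-trans e e')
⊩Λ-conv-ctx e (cons d l e') = cons d l (~E-trans e e')

⊩-conv : Γ' ~E Γ → Q ~ Q' → Γ ⊩⟨ n ⟩ t ∶ Q → Γ' ⊩⟨ n ⟩ t ∶ Q'
⊩-conv e q (ax i e')         = ax i (λ j → e j ◅◅ e' j ◅◅ ↦-cong i q j)
⊩-conv e q (app d₁ d₂ e' q') = app d₁ d₂ (~E-trans e e') (q' ◅◅ q)
⊩-conv e q (lam l q')        = lam (⊩Λ-conv-ctx e l) (q' ◅◅ q)

⊩-conv-ctx : Γ' ~E Γ → Γ ⊩⟨ n ⟩ t ∶ Q → Γ' ⊩⟨ n ⟩ t ∶ Q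
⊩-conv-ctx e = ⊩-conv e ε

⊩-resize : n ≡ m → Γ ⊩⟨ n ⟩ t ∶ Q → Γ ⊩⟨ m ⟩ t ∶ Q
⊩-resize refl d = d

⊩Λ-resize : n ≡ m → Γ ⊩Λ⟨ n ⟩ t ∶ A → Γ ⊩Λ⟨ m ⟩ t ∶ A
⊩Λ-resize refl l = l

⊩Λ-perm : A ↭ B → Γ ⊩Λ⟨ n ⟩ t ∶ A → Γ ⊩Λ⟨ n ⟩ t ∶ B
⊩Λ-perm ↭.refl         l            = l
⊩Λ-perm (↭.prep _ p)   (cons d l e) = cons d (⊩Λ-perm p l) e
⊩Λ-perm (↭.swap _ _ p) (cons {Γ₁ = Γ₁} {n = n₁} d₁ (cons {Γ₁ = Γ₂} {Γ₂ = Δ} {n = n₂} {m = m} d₂ l e₂) e₁) =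
  ⊩Λ-resize (x∙yz≈y∙xz n₂ n₁ m)
    (cons d₂ (cons d₁ (⊩Λ-perm p l) ~E-refl) (~E-trans e₁ (~E-trans (⊞-congʳ Γ₁ e₂) (⊞-swap Γ₁ Γ₂ Δ))))
⊩Λ-perm (↭.trans p q)  l            = ⊩Λ-perm q (⊩Λ-perm p l)

⊩Λ-pointwise : Pointwise _≈N_ A B → Γ ⊩Λ⟨ n ⟩ t ∶ A → Γ ⊩Λ⟨ n ⟩ t ∶ B
⊩Λ-pointwise []                 (nil e)      = nil e
⊩Λ-pointwise (⊸-cong p q ∷ pw) (cons d l e) =
  cons (⊩-conv (∷ᶜ-cong (≈P-sym p) ~E-refl) (q ◅ ε) d) (⊩Λ-pointwise pw l) e

⊩Λ-conv : A ~ B → Γ ⊩Λ⟨ n ⟩ t ∶ A → Γ ⊩Λ⟨ n ⟩ t ∶ B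
⊩Λ-conv ε                   l = l
⊩Λ-conv (perm p pw ◅ steps) l = ⊩Λ-conv steps (⊩Λ-pointwise pw (⊩Λ-perm p l))

lam-single : P ∷ᶜ Γ ⊩⟨ n ⟩ t ∶ Q → Γ ⊩⟨ n ⟩ lam t ∶ (P ⊸ Q) ∷ []
lam-single {Γ = Γ} {n = n} d =
  lam (⊩Λ-resize (+-identityʳ n) (cons d (nil ~E-refl) (~E-sym (⊞-identityʳ Γ)))) ε

lam-single⁻¹ : Γ ⊩⟨ n ⟩ lam t ∶ (P ⊸ Q) ∷ [] → P ∷ᶜ Γ ⊩⟨ n ⟩ t ∶ Q
lam-single⁻¹ (lam l q) with ⊩Λ-conv q l
... | cons {Γ₁ = Γ₁} {n = n} d (nil e₀) e =
  ⊩-resize (≡.sym (+-identityʳ n))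
    (⊩-conv-ctx (∷ᶜ-cong ε (~E-trans e (~E-trans (⊞-congʳ Γ₁ e₀) (⊞-identityʳ Γ₁)))) d)

-- Values

record Split {k : ℕ} {I : Set} (J : Ctx k → ℕ → I → Set) (Γ : Ctx k) (n : ℕ) (A B : I) : Set where
  constructor split
  field
    ctxˡ ctxʳ   : Ctx k
    sizeˡ sizeʳ : ℕ
    left        : J ctxˡ sizeˡ A
    right       : J ctxʳ sizeʳ B
    ctx-eq      : Γ ~E ctxˡ ⊞ ctxʳ
    size-eq     : n ≡ sizeˡ + sizeʳ

⊩Λ-split : ∀ A → Γ ⊩Λ⟨ n ⟩ t ∶ A ++ B → Split (_⊩Λ⟨_⟩ t ∶_) Γ n A B
⊩Λ-split []      l = split ∅ _ 0 _ (nil ~E-refl) l ~E-refl refl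
⊩Λ-split (_ ∷ A) (cons {Γ₁ = Γ₀} {n = n₀} d l e) with ⊩Λ-split A l
... | split Γ₁ Γ₂ n₁ n₂ l₁ l₂ e' s =
  split (Γ₀ ⊞ Γ₁) Γ₂ (n₀ + n₁) n₂ (cons d l₁ ~E-refl) l₂
    (~E-trans e (~E-trans (⊞-congʳ Γ₀ e') (~E-sym (⊞-assoc Γ₀ Γ₁ Γ₂))))
    (≡.trans (≡.cong (n₀ +_) s) (≡.sym (+-assoc n₀ n₁ n₂)))

⊩Λ-append : Γ ⊩Λ⟨ n ⟩ t ∶ A → Δ ⊩Λ⟨ m ⟩ t ∶ B → Γ ⊞ Δ ⊩Λ⟨ n + m ⟩ t ∶ A ++ B
⊩Λ-append {Δ = Δ} (nil e) l₂ = ⊩Λ-conv-ctx (⊞-congˡ Δ e) l₂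
⊩Λ-append {Δ = Δ} {m = m} (cons {Γ₁ = Γ₁} {Γ₂} {n = n₁} {m = n₂} d l e) l₂ =
  ⊩Λ-resize (≡.sym (+-assoc n₁ n₂ m))
    (cons d (⊩Λ-append l l₂) (~E-trans (⊞-congˡ Δ e) (⊞-assoc Γ₁ Γ₂ Δ)))

value-𝟎 : Value v → ∅ ⊩⟨ 0 ⟩ v ∶ []
value-𝟎 (var i) = ax i (λ j → ≡⇒~ (≡.sym (↦-[] i j)))
value-𝟎 (lam t) = lam (nil ~E-refl) ε

value-𝟎⁻¹ : Value v → Γ ⊩⟨ n ⟩ v ∶ [] → Γ ~E ∅ × n ≡ 0
value-𝟎⁻¹ (var i) (ax _ e) = (λ j → e j ◅◅ ≡⇒~ (↦-[] i j)) , refl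
value-𝟎⁻¹ (lam t) (lam l q) with ⊩Λ-conv q l
... | nil e = e , refl

value-split : Value v → ∀ A B → Γ ⊩⟨ n ⟩ v ∶ A ++ B → Split (_⊩⟨_⟩ v ∶_) Γ n A B
value-split (var i) A B (ax _ e) =
  split _ _ 0 0 (ax i ~E-refl) (ax i ~E-refl) (λ j → e j ◅◅ ↦-++ i A B j) refl
value-split (lam t) A B (lam l q) with ⊩Λ-split A (⊩Λ-conv q l)
... | split Γ₁ Γ₂ n₁ n₂ l₁ l₂ e s = split Γ₁ Γ₂ n₁ n₂ (lam l₁ ε) (lam l₂ ε) e s

value-merge : Value v → Γ ⊩⟨ n ⟩ v ∶ A → Δ ⊩⟨ m ⟩ v ∶ B → Γ ⊞ Δ ⊩⟨ n + m ⟩ v ∶ A ++ B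
value-merge {A = A} {B = B} (var i) (ax _ e₁) (ax _ e₂) =
  ax i (λ j → ++-cong (e₁ j) (e₂ j) ◅◅ ~-sym (↦-++ i A B j))
value-merge (lam t) (lam l₁ q₁) (lam l₂ q₂) = lam (⊩Λ-append (⊩Λ-conv q₁ l₁) (⊩Λ-conv q₂ l₂)) ε

-- Renaming

module ΣP = MonoidSum Pos-commutativeMonoid

⨁ : (Fin a → Ctx k) → Ctx k
⨁ f j = ΣP.sum (λ i → f i j)

⨁-cong : {f g : Fin a → Ctx k} → (∀ i → f i ~E g i) → ⨁ f ~E ⨁ g
⨁-cong e j = ΣP.sum-cong-≋ (λ i → e i j)

⨁-⊞ : (f g : Fin a → Ctx k) → ⨁ (λ i → f i ⊞ g i) ~E ⨁ f ⊞ ⨁ g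
⨁-⊞ f g j = ΣP.∑-distrib-+ (λ i → f i j) (λ i → g i j)

⨁-∅ : {f : Fin a → Ctx k} → (∀ i → f i ~E ∅) → ⨁ f ~E ∅
⨁-∅ {a = a} e j = ΣP.sum-cong-≋ (λ i → e i j) ◅◅ ΣP.sum-replicate-zero a

sum-↦-pick : (g : Fin a → Pos → Pos) → (∀ i → g i [] ≡ []) →
             ∀ i P → ΣP.sum (λ i' → g i' ((i ↦ P) i')) ~ g i P
sum-↦-pick {a = suc a} g g[] zero P =
  ++-cong ε (ΣP.sum-cong-≋ (λ i → ≡⇒~ (g[] (suc i))) ◅◅ ΣP.sum-replicate-zero a)
    ◅◅ ≡⇒~ (++-identityʳ (g zero P))
sum-↦-pick {a = suc a} g g[] (suc i) P =
  ++-cong (≡⇒~ (g[] zero)) (sum-↦-pick (tail g) (g[] ∘ suc) i P)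

sum-↦-diag : (g : Fin a → Pos) → ∀ j → ΣP.sum (λ i → (i ↦ g i) j) ~ g j
sum-↦-diag {a = suc a} g zero    = ++-cong ε (ΣP.sum-replicate-zero a) ◅◅ ≡⇒~ (++-identityʳ (g zero))
sum-↦-diag {a = suc a} g (suc j) = sum-↦-diag (tail g) j

-- push ρ Γ is the environment of rename ρ t for t typed in Γ: variable j receives the sum of
-- the types of the variables that ρ sends to j.
push : (Fin a → Fin b) → Ctx a → Ctx b
push ρ Γ = ⨁ (λ i → ρ i ↦ Γ i)

push-↦ : (ρ : Fin a → Fin b) (i : Fin a) (P : Pos) → push ρ (i ↦ P) ~E ρ i ↦ P
push-↦ ρ i P j = sum-↦-pick (λ i' X → (ρ i' ↦ X) j) (λ i' → ↦-[] (ρ i') j) i P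

push-⊞ : (ρ : Fin a → Fin b) (Γ Δ : Ctx a) → push ρ (Γ ⊞ Δ) ~E push ρ Γ ⊞ push ρ Δ
push-⊞ ρ Γ Δ = ~E-trans (⨁-cong (λ i → ↦-++ (ρ i) (Γ i) (Δ i))) (⨁-⊞ (λ i → ρ i ↦ Γ i) (λ i → ρ i ↦ Δ i))

push-∅ : (ρ : Fin a → Fin b) → push ρ ∅ ~E ∅
push-∅ ρ = ⨁-∅ (λ i j → ≡⇒~ (↦-[] (ρ i) j))

push-cong : (ρ : Fin a → Fin b) → Γ ~E Δ → push ρ Γ ~E push ρ Δ
push-cong ρ e = ⨁-cong (λ i → ↦-cong (ρ i) (e i))

push-ext : (ρ : Fin a → Fin b) (Γ : Ctx (suc a)) → push (ext ρ) Γ ~E Γ zero ∷ᶜ push ρ (tail Γ)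
push-ext {a = a} ρ Γ zero = ++-cong ε (ΣP.sum-replicate-zero a) ◅◅ ≡⇒~ (++-identityʳ (Γ zero))
push-ext ρ Γ (suc j) = ε

push-suc : (Γ : Ctx a) → push suc Γ ~E [] ∷ᶜ Γ
push-suc {a = a} Γ zero    = ΣP.sum-replicate-zero a
push-suc         Γ (suc j) = sum-↦-diag Γ j

mutual
  ⊩-rename : (ρ : Fin a → Fin b) → Γ ⊩⟨ n ⟩ t ∶ Q → push ρ Γ ⊩⟨ n ⟩ rename ρ t ∶ Q
  ⊩-rename ρ (ax i {P} e) = ax (ρ i) (λ j → push-cong ρ e j ◅◅ push-↦ ρ i P j)
  ⊩-rename ρ (app {Γ₁ = Γ₁} {Γ₂} d₁ d₂ e q) =
    app (⊩-rename ρ d₁) (⊩-rename ρ d₂) (~E-trans (push-cong ρ e) (push-⊞ ρ Γ₁ Γ₂)) q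
  ⊩-rename ρ (lam l q) = lam (⊩Λ-rename ρ l) q

  ⊩Λ-rename : (ρ : Fin a → Fin b) → Γ ⊩Λ⟨ n ⟩ t ∶ A → push ρ Γ ⊩Λ⟨ n ⟩ rename (ext ρ) t ∶ A
  ⊩Λ-rename ρ (nil e) = nil (~E-trans (push-cong ρ e) (push-∅ ρ))
  ⊩Λ-rename ρ (cons {Γ₁ = Γ₁} {Γ₂} {P = P} d l e) =
    cons (⊩-conv-ctx (~E-sym (push-ext ρ (P ∷ᶜ Γ₁))) (⊩-rename (ext ρ) d)) (⊩Λ-rename ρ l)
      (~E-trans (push-cong ρ e) (push-⊞ ρ Γ₁ Γ₂))

mutual
  ⊩-unrename : (ρ : Fin a → Fin b) (t : Tm a) → Γ ⊩⟨ n ⟩ rename ρ t ∶ Q →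
               ∃[ Γ' ] (Γ ~E push ρ Γ' × Γ' ⊩⟨ n ⟩ t ∶ Q)
  ⊩-unrename {Q = Q} ρ (var i) (ax _ e) = i ↦ Q , (λ j → e j ◅◅ ~-sym (push-↦ ρ i Q j)) , ax i ~E-refl
  ⊩-unrename ρ (app t u) (app d₁ d₂ e q) with ⊩-unrename ρ t d₁ | ⊩-unrename ρ u d₂
  ... | Γ₁ , e₁ , d₁' | Γ₂ , e₂ , d₂' =
    Γ₁ ⊞ Γ₂ , ~E-trans e (~E-trans (⊞-cong e₁ e₂) (~E-sym (push-⊞ ρ Γ₁ Γ₂))) , app d₁' d₂' ~E-refl q
  ⊩-unrename ρ (lam t) (lam l q) with ⊩Λ-unrename ρ t l
  ... | Γ' , e , l' = Γ' , e , lam l' q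

  ⊩Λ-unrename : (ρ : Fin a → Fin b) (t : Tm (suc a)) → Γ ⊩Λ⟨ n ⟩ rename (ext ρ) t ∶ A →
                ∃[ Γ' ] (Γ ~E push ρ Γ' × Γ' ⊩Λ⟨ n ⟩ t ∶ A)
  ⊩Λ-unrename ρ t (nil e) = ∅ , ~E-trans e (~E-sym (push-∅ ρ)) , nil ~E-refl
  ⊩Λ-unrename ρ t (cons d l e) with ⊩-unrename (ext ρ) t d | ⊩Λ-unrename ρ t l
  ... | Γ₁ , e₁ , d' | Γ₂ , e₂ , l' =
    tail Γ₁ ⊞ Γ₂ ,
    ~E-trans e (~E-trans (⊞-cong (λ i → e₁ (suc i)) e₂) (~E-sym (push-⊞ ρ (tail Γ₁) Γ₂))) ,
    cons (⊩-conv-ctx (~E-trans (∷ᶜ-cong (e₁ zero ◅◅ push-ext ρ Γ₁ zero) ~E-refl) (∷ᶜ-η Γ₁)) d') l' ~E-refl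

⊩-weaken : Γ ⊩⟨ n ⟩ t ∶ Q → [] ∷ᶜ Γ ⊩⟨ n ⟩ weaken t ∶ Q
⊩-weaken {Γ = Γ} d = ⊩-conv-ctx (~E-sym (push-suc Γ)) (⊩-rename suc d)

⊩-strengthen : (t : Tm k) → Γ ⊩⟨ n ⟩ weaken t ∶ Q → ∃[ Γ' ] (Γ ~E [] ∷ᶜ Γ' × Γ' ⊩⟨ n ⟩ t ∶ Q)
⊩-strengthen t d with ⊩-unrename suc t d
... | Γ' , e , d' = Γ' , ~E-trans e (push-suc Γ') , d'

-- Substitution

var-inv : {i : Fin k} → Γ ⊩⟨ n ⟩ var i ∶ P → Γ ~E i ↦ P × n ≡ 0
var-inv (ax _ e) = e , refl

AllValues : (Fin a → Tm b) → Set
AllValues θ = ∀ i → Value (θ i)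

Value-rename : (ρ : Fin a → Fin b) → Value v → Value (rename ρ v)
Value-rename ρ (var i) = var (ρ i)
Value-rename ρ (lam t) = lam _

Value-exts : AllValues θ → AllValues (exts θ)
Value-exts vals zero    = var zero
Value-exts vals (suc i) = Value-rename suc (vals i)

infix 4 _⊩ˢ⟨_⟩_∶_

data _⊩ˢ⟨_⟩_∶_ {b : ℕ} : {a : ℕ} → Ctx b → ℕ → (Fin a → Tm b) → Ctx a → Set where
  nil  : {Δ : Ctx b} {θ : Fin 0 → Tm b} {Γ : Ctx 0} → Δ ~E ∅ → Δ ⊩ˢ⟨ 0 ⟩ θ ∶ Γ
  cons : {a : ℕ} {Δ Δ₀ Δ' : Ctx b} {m₀ m' : ℕ} {θ : Fin (suc a) → Tm b} {Γ : Ctx (suc a)} →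
         Δ₀ ⊩⟨ m₀ ⟩ θ zero ∶ Γ zero → Δ' ⊩ˢ⟨ m' ⟩ tail θ ∶ tail Γ →
         Δ ~E Δ₀ ⊞ Δ' → Δ ⊩ˢ⟨ m₀ + m' ⟩ θ ∶ Γ

⊩ˢ-resize : n ≡ m → Δ ⊩ˢ⟨ n ⟩ θ ∶ Γ → Δ ⊩ˢ⟨ m ⟩ θ ∶ Γ
⊩ˢ-resize refl τ = τ

⊩ˢ-conv-ctx : Δ₁ ~E Δ → Δ ⊩ˢ⟨ m ⟩ θ ∶ Γ → Δ₁ ⊩ˢ⟨ m ⟩ θ ∶ Γ
⊩ˢ-conv-ctx e (nil e')      = nil (~E-trans e e')
⊩ˢ-conv-ctx e (cons d τ e') = cons d τ (~E-trans e e')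

⊩ˢ-conv : Γ ~E Γ' → Δ ⊩ˢ⟨ m ⟩ θ ∶ Γ → Δ ⊩ˢ⟨ m ⟩ θ ∶ Γ'
⊩ˢ-conv e (nil e')      = nil e'
⊩ˢ-conv e (cons d τ e') = cons (⊩-conv ~E-refl (e zero) d) (⊩ˢ-conv (λ i → e (suc i)) τ) e'

⊩ˢ-split : AllValues θ → (Γ₁ Γ₂ : Ctx a) → Δ ⊩ˢ⟨ m ⟩ θ ∶ Γ₁ ⊞ Γ₂ → Split (_⊩ˢ⟨_⟩ θ ∶_) Δ m Γ₁ Γ₂
⊩ˢ-split vals Γ₁ Γ₂ (nil e) = split ∅ ∅ 0 0 (nil ~E-refl) (nil ~E-refl) e refl
⊩ˢ-split vals Γ₁ Γ₂ (cons d τ e)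
  with value-split (vals zero) (Γ₁ zero) (Γ₂ zero) d
     | ⊩ˢ-split (vals ∘ suc) (tail Γ₁) (tail Γ₂) τ
... | split Δa Δb na nb da db ea refl | split Δc Δd nc nd τc τd ec refl =
  split (Δa ⊞ Δc) (Δb ⊞ Δd) (na + nc) (nb + nd) (cons da τc ~E-refl) (cons db τd ~E-refl)
    (~E-trans e (~E-trans (⊞-cong ea ec) (⊞-interchange Δa Δb Δc Δd)))
    (interchange na nb nc nd)

⊩ˢ-merge : AllValues θ → Δ₁ ⊩ˢ⟨ n ⟩ θ ∶ Γ₁ → Δ₂ ⊩ˢ⟨ m ⟩ θ ∶ Γ₂ → Δ₁ ⊞ Δ₂ ⊩ˢ⟨ n + m ⟩ θ ∶ Γ₁ ⊞ Γ₂
⊩ˢ-merge vals (nil e₁) (nil e₂) = nil (⊞-cong e₁ e₂)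
⊩ˢ-merge vals (cons {Δ₀ = Δa} {Δb} {na} {nb} d₁ τ₁ e₁) (cons {Δ₀ = Δc} {Δd} {nc} {nd} d₂ τ₂ e₂) =
  ⊩ˢ-resize (interchange na nc nb nd)
    (cons (value-merge (vals zero) d₁ d₂) (⊩ˢ-merge (vals ∘ suc) τ₁ τ₂)
      (~E-trans (⊞-cong e₁ e₂) (⊞-interchange Δa Δb Δc Δd)))

⊩ˢ-∅ : {a b : ℕ} {θ : Fin a → Tm b} → AllValues θ → ∅ ⊩ˢ⟨ 0 ⟩ θ ∶ ∅
⊩ˢ-∅ {a = zero}  vals = nil ~E-refl
⊩ˢ-∅ {a = suc a} vals = cons (value-𝟎 (vals zero)) (⊩ˢ-∅ (vals ∘ suc)) ~E-refl

⊩ˢ-∅⁻¹ : AllValues θ → Δ ⊩ˢ⟨ m ⟩ θ ∶ ∅ → Δ ~E ∅ × m ≡ 0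
⊩ˢ-∅⁻¹ vals (nil e) = e , refl
⊩ˢ-∅⁻¹ vals (cons d τ e) with value-𝟎⁻¹ (vals zero) d | ⊩ˢ-∅⁻¹ (vals ∘ suc) τ
... | e₀ , refl | e' , refl = ~E-trans e (⊞-cong e₀ e') , refl

⊩ˢ-↦ : AllValues θ → ∀ i → Δ ⊩⟨ m ⟩ θ i ∶ Q → Δ ⊩ˢ⟨ m ⟩ θ ∶ i ↦ Q
⊩ˢ-↦ {Δ = Δ} {m = m} vals zero d =
  ⊩ˢ-resize (+-identityʳ m) (cons d (⊩ˢ-∅ (vals ∘ suc)) (~E-sym (⊞-identityʳ Δ)))
⊩ˢ-↦ vals (suc i) d = cons (value-𝟎 (vals zero)) (⊩ˢ-↦ (vals ∘ suc) i d) ~E-refl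

⊩ˢ-↦⁻¹ : AllValues θ → ∀ i → Δ ⊩ˢ⟨ m ⟩ θ ∶ i ↦ Q → Δ ⊩⟨ m ⟩ θ i ∶ Q
⊩ˢ-↦⁻¹ vals zero (cons {Δ₀ = Δ₀} {m₀ = m₀} d τ e) with ⊩ˢ-∅⁻¹ (vals ∘ suc) τ
... | e' , refl =
  ⊩-resize (≡.sym (+-identityʳ m₀)) (⊩-conv-ctx (~E-trans e (~E-trans (⊞-congʳ Δ₀ e') (⊞-identityʳ Δ₀))) d)
⊩ˢ-↦⁻¹ vals (suc i) (cons {Δ' = Δ'} d τ e) with value-𝟎⁻¹ (vals zero) d
... | e₀ , refl = ⊩-conv-ctx (~E-trans e (⊞-congˡ Δ' e₀)) (⊩ˢ-↦⁻¹ (vals ∘ suc) i τ)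

⊩ˢ-weaken : Δ ⊩ˢ⟨ m ⟩ θ ∶ Γ → [] ∷ᶜ Δ ⊩ˢ⟨ m ⟩ (λ i → weaken (θ i)) ∶ Γ
⊩ˢ-weaken (nil e)      = nil (λ { zero → ε ; (suc i) → e i })
⊩ˢ-weaken (cons {Δ₀ = Δ₀} {Δ'} d τ e) =
  cons (⊩-weaken d) (⊩ˢ-weaken τ) (~E-trans (∷ᶜ-cong ε e) (~E-sym (∷ᶜ-⊞ [] [] Δ₀ Δ')))

⊩ˢ-strengthen : (θ : Fin a → Tm b) → Δ ⊩ˢ⟨ m ⟩ (λ i → weaken (θ i)) ∶ Γ →
                ∃[ Δ' ] (Δ ~E [] ∷ᶜ Δ' × Δ' ⊩ˢ⟨ m ⟩ θ ∶ Γ)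
⊩ˢ-strengthen θ (nil e) = ∅ , ~E-trans e (λ { zero → ε ; (suc i) → ε }) , nil ~E-refl
⊩ˢ-strengthen θ (cons d τ e) with ⊩-strengthen (θ zero) d | ⊩ˢ-strengthen (tail θ) τ
... | Δ₀ , e₀ , d' | Δ' , e' , τ' =
  Δ₀ ⊞ Δ' , ~E-trans e (~E-trans (⊞-cong e₀ e') (∷ᶜ-⊞ [] [] Δ₀ Δ')) , cons d' τ' ~E-refl

⊩ˢ-exts : Δ ⊩ˢ⟨ m ⟩ θ ∶ Γ → P ∷ᶜ Δ ⊩ˢ⟨ m ⟩ exts θ ∶ P ∷ᶜ Γ
⊩ˢ-exts {Δ = Δ} {P = P} τ = cons (ax zero ~E-refl) (⊩ˢ-weaken τ) (∷ᶜ-split P Δ)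

⊩ˢ-exts⁻¹ : (θ : Fin a → Tm b) → Δ ⊩ˢ⟨ m ⟩ exts θ ∶ Γ →
            ∃[ Δ' ] (Δ ~E Γ zero ∷ᶜ Δ' × Δ' ⊩ˢ⟨ m ⟩ θ ∶ tail Γ)
⊩ˢ-exts⁻¹ {Γ = Γ} θ (cons d τ e) with var-inv d | ⊩ˢ-strengthen θ τ
... | e₀ , refl | Δ' , e' , τ' =
  Δ' , ~E-trans e (~E-trans (⊞-cong e₀ e') (~E-sym (∷ᶜ-split (Γ zero) Δ'))) , τ'

⊩ˢ-var : {a : ℕ} (Γ : Ctx a) → Γ ⊩ˢ⟨ 0 ⟩ var ∶ Γ
⊩ˢ-var {a = zero}  Γ = nil (λ ())
⊩ˢ-var {a = suc a} Γ =
  cons (ax zero ~E-refl) (⊩ˢ-weaken (⊩ˢ-var (tail Γ)))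
    (~E-trans (~E-sym (∷ᶜ-η Γ)) (∷ᶜ-split (Γ zero) (tail Γ)))

⊩ˢ-var⁻¹ : Δ ⊩ˢ⟨ m ⟩ var ∶ Γ → Δ ~E Γ
⊩ˢ-var⁻¹ (nil e) = ~E-trans e (λ ())
⊩ˢ-var⁻¹ {Γ = Γ} (cons d τ e) with var-inv d | ⊩ˢ-strengthen var τ
... | e₀ , refl | Δ' , e' , τ' =
  ~E-trans e (~E-trans (⊞-cong e₀ e')
    (~E-trans (~E-sym (∷ᶜ-split (Γ zero) Δ')) (~E-trans (∷ᶜ-cong ε (⊩ˢ-var⁻¹ τ')) (∷ᶜ-η Γ))))

mutual
  ⊩-subst : AllValues θ → Γ ⊩⟨ n ⟩ t ∶ Q → Δ ⊩ˢ⟨ m ⟩ θ ∶ Γ → Δ ⊩⟨ n + m ⟩ subst θ t ∶ Q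
  ⊩-subst vals (ax i e) τ = ⊩ˢ-↦⁻¹ vals i (⊩ˢ-conv e τ)
  ⊩-subst vals (app {Γ₁ = Γ₁} {Γ₂} {n₁ = n₁} {n₂} d₁ d₂ e q) τ with ⊩ˢ-split vals Γ₁ Γ₂ (⊩ˢ-conv e τ)
  ... | split _ _ m₁ m₂ τ₁ τ₂ e' refl =
    ⊩-resize (≡.cong suc (interchange n₁ m₁ n₂ m₂)) (app (⊩-subst vals d₁ τ₁) (⊩-subst vals d₂ τ₂) e' q)
  ⊩-subst vals (lam l q) τ = lam (⊩Λ-subst vals l τ) q

  ⊩Λ-subst : AllValues θ → Γ ⊩Λ⟨ n ⟩ t ∶ A → Δ ⊩ˢ⟨ m ⟩ θ ∶ Γ → Δ ⊩Λ⟨ n + m ⟩ subst (exts θ) t ∶ A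
  ⊩Λ-subst vals (nil e) τ with ⊩ˢ-∅⁻¹ vals (⊩ˢ-conv e τ)
  ... | e' , refl = nil e'
  ⊩Λ-subst vals (cons {Γ₁ = Γ₁} {Γ₂} {n = n₁} {m = n₂} d l e) τ with ⊩ˢ-split vals Γ₁ Γ₂ (⊩ˢ-conv e τ)
  ... | split _ _ m₁ m₂ τ₁ τ₂ e' refl =
    ⊩Λ-resize (interchange n₁ m₁ n₂ m₂)
      (cons (⊩-subst (Value-exts vals) d (⊩ˢ-exts τ₁)) (⊩Λ-subst vals l τ₂) e')

mutual
  ⊩-unsubst : AllValues θ → (t : Tm a) → Δ ⊩⟨ n ⟩ subst θ t ∶ Q →
              ∃[ Γ ] ∃[ n' ] ∃[ m ] (Γ ⊩⟨ n' ⟩ t ∶ Q × Δ ⊩ˢ⟨ m ⟩ θ ∶ Γ)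
  ⊩-unsubst {Q = Q} vals (var i) d = i ↦ Q , 0 , _ , ax i ~E-refl , ⊩ˢ-↦ vals i d
  ⊩-unsubst vals (app t u) (app d₁ d₂ e q) with ⊩-unsubst vals t d₁ | ⊩-unsubst vals u d₂
  ... | Γ₁ , _ , _ , d₁' , τ₁ | Γ₂ , _ , _ , d₂' , τ₂ =
    Γ₁ ⊞ Γ₂ , _ , _ , app d₁' d₂' ~E-refl q , ⊩ˢ-conv-ctx e (⊩ˢ-merge vals τ₁ τ₂)
  ⊩-unsubst vals (lam t) (lam l q) with ⊩Λ-unsubst vals t l
  ... | Γ , _ , _ , l' , τ = Γ , _ , _ , lam l' q , τ

  ⊩Λ-unsubst : AllValues θ → (t : Tm (suc a)) → Δ ⊩Λ⟨ n ⟩ subst (exts θ) t ∶ A →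
               ∃[ Γ ] ∃[ n' ] ∃[ m ] (Γ ⊩Λ⟨ n' ⟩ t ∶ A × Δ ⊩ˢ⟨ m ⟩ θ ∶ Γ)
  ⊩Λ-unsubst vals t (nil e) = ∅ , 0 , 0 , nil ~E-refl , ⊩ˢ-conv-ctx e (⊩ˢ-∅ vals)
  ⊩Λ-unsubst {θ = θ} vals t (cons {Γ₂ = Δ₂} d l e) with ⊩-unsubst (Value-exts vals) t d | ⊩Λ-unsubst vals t l
  ... | Γ₁ , _ , _ , d' , τ₁ | Γ₂ , _ , _ , l' , τ₂ with ⊩ˢ-exts⁻¹ θ τ₁
  ... | _ , e₁ , τ₁' =
    tail Γ₁ ⊞ Γ₂ , _ , _ ,
    cons (⊩-conv-ctx (~E-trans (∷ᶜ-cong (e₁ zero) ~E-refl) (∷ᶜ-η Γ₁)) d') l' ~E-refl ,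
    ⊩ˢ-conv-ctx (~E-trans e (⊞-congˡ Δ₂ (λ i → e₁ (suc i)))) (⊩ˢ-merge vals τ₁' τ₂)

sub₀ : Tm k → Fin (suc k) → Tm k
sub₀ v zero    = v
sub₀ v (suc i) = var i

Value-sub₀ : Value v → AllValues (sub₀ v)
Value-sub₀ vv zero    = vv
Value-sub₀ vv (suc i) = var i

subst-cong : {θ θ' : Fin a → Tm b} → (∀ i → θ i ≡ θ' i) → ∀ t → subst θ t ≡ subst θ' t
subst-cong eq (var i)   = eq i
subst-cong eq (lam t)   = ≡.cong lam (subst-cong (λ { zero → refl ; (suc i) → ≡.cong weaken (eq i) }) t)
subst-cong eq (app t u) = ≡.cong₂ app (subst-cong eq t) (subst-cong eq u)

[]-sub₀ : (t : Tm (suc k)) (v : Tm k) → t [ v ] ≡ subst (sub₀ v) t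
[]-sub₀ t v = subst-cong (λ { zero → refl ; (suc i) → refl }) t

⊩-[] : {Γ Δ : Ctx k} {t : Tm (suc k)} {v : Tm k} {P Q : Pos} {n m : ℕ} →
       P ∷ᶜ Γ ⊩⟨ n ⟩ t ∶ Q → Value v → Δ ⊩⟨ m ⟩ v ∶ P → Δ ⊞ Γ ⊩⟨ n + m ⟩ t [ v ] ∶ Q
⊩-[] {Γ = Γ} {Δ} {t} {v} {Q = Q} {n} {m} d vv dv =
  ≡.subst (λ s → Δ ⊞ Γ ⊩⟨ n + m ⟩ s ∶ Q) (≡.sym ([]-sub₀ t v))
    (⊩-resize (≡.cong (n +_) (+-identityʳ m)) (⊩-subst (Value-sub₀ vv) d (cons dv (⊩ˢ-var Γ) ~E-refl)))

-- Subject reduction and expansion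

βv-reduce : Value v → Γ ⊩⟨ suc n ⟩ app (lam t) v ∶ Q → Γ ⊩⟨ n ⟩ t [ v ] ∶ Q
βv-reduce vv (app {Γ₁ = Γ₁} {Γ₂} d₁ d₂ e q) =
  ⊩-conv (~E-trans e (⊞-comm Γ₁ Γ₂)) q (⊩-[] (lam-single⁻¹ d₁) vv d₂)

βv-expand : {Γ : Ctx k} {t : Tm (suc k)} {v : Tm k} {Q : Pos} {n : ℕ} →
            Value v → Γ ⊩⟨ n ⟩ t [ v ] ∶ Q → ∃[ n' ] Γ ⊩⟨ n' ⟩ app (lam t) v ∶ Q
βv-expand {Γ = Γ} {t} {v} {Q} {n} vv d
  with ⊩-unsubst (Value-sub₀ vv) t (≡.subst (λ s → Γ ⊩⟨ n ⟩ s ∶ Q) ([]-sub₀ t v) d)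
... | Γ' , _ , _ , d' , cons {Δ₀ = Δ₀} dv τ e =
  _ , app (lam-single (⊩-conv-ctx (∷ᶜ-η Γ') d')) dv
        (~E-trans e (~E-trans (⊞-congʳ Δ₀ (⊩ˢ-var⁻¹ τ)) (⊞-comm Δ₀ (tail Γ')))) ε

σ₁-reduce : {t : Tm (suc k)} →
            Γ ⊩⟨ n ⟩ app (app (lam t) u) v ∶ Q → Γ ⊩⟨ n ⟩ app (lam (app t (weaken v))) u ∶ Q
σ₁-reduce (app {Γ₂ = Γ₂} {n₂ = n₂} (app {Γ₁ = Γ₁₁} {Γ₁₂} {P = R} {n₁ = m₁} {m₂} dλ du e' q') ds e q) =
  ⊩-resize (≡.cong (λ x → suc (suc x)) (xy∙z≈xz∙y m₁ n₂ m₂))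
    (app (lam-single (app (⊩-conv ~E-refl q' (lam-single⁻¹ dλ)) (⊩-weaken ds) inner ε)) du
      (~E-trans e (~E-trans (⊞-congˡ Γ₂ e') (⊞-rotate Γ₁₁ Γ₁₂ Γ₂))) q)
  where
  inner : R ∷ᶜ (Γ₁₁ ⊞ Γ₂) ~E (R ∷ᶜ Γ₁₁) ⊞ ([] ∷ᶜ Γ₂)
  inner = ~E-trans (∷ᶜ-cong (≡⇒~ (≡.sym (++-identityʳ R))) ~E-refl) (~E-sym (∷ᶜ-⊞ R [] Γ₁₁ Γ₂))

σ₃-reduce : {u : Tm (suc k)} →
            Γ ⊩⟨ n ⟩ app v (app (lam u) t) ∶ Q → Γ ⊩⟨ n ⟩ app (lam (app (weaken v) u)) t ∶ Q
σ₃-reduce (app {Γ₁ = Γ₁} {n₁ = n₁} dv (app {Γ₁ = Γ₂₁} {Γ₂₂} {P = R} {n₁ = m₁} {m₂} dλ dt e' q') e q) =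
  ⊩-resize (≡.cong suc (≡.trans (≡.cong suc (+-assoc n₁ m₁ m₂)) (≡.sym (+-suc n₁ (m₁ + m₂)))))
    (app (lam-single (app (⊩-weaken dv) (⊩-conv ~E-refl q' (lam-single⁻¹ dλ)) (~E-sym (∷ᶜ-⊞ [] R Γ₁ Γ₂₁)) ε)) dt
      (~E-trans e (~E-trans (⊞-congʳ Γ₁ e') (~E-sym (⊞-assoc Γ₁ Γ₂₁ Γ₂₂)))) q)

σ₁-expand : {t : Tm (suc k)} →
            Γ ⊩⟨ n ⟩ app (lam (app t (weaken v))) u ∶ Q → ∃[ n' ] Γ ⊩⟨ n' ⟩ app (app (lam t) u) v ∶ Q
σ₁-expand {v = v} (app {Γ₁ = Γ₁} {Γ₂} {P = R} dλ du e q) with lam-single⁻¹ dλ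
... | app {Γ₁ = E₁} {E₂} dt dwv e' q' with ⊩-strengthen v dwv
... | E₂' , eS , dv =
  _ , app (app (lam-single (⊩-conv-ctx body-ctx dt)) du ~E-refl ε) dv
        (~E-trans e (~E-trans (⊞-congˡ Γ₂ (λ i → e'' (suc i))) (⊞-rotate (tail E₁) E₂' Γ₂))) (q' ◅◅ q)
  where
  e'' : R ∷ᶜ Γ₁ ~E E₁ ⊞ ([] ∷ᶜ E₂')
  e'' = ~E-trans e' (⊞-congʳ E₁ eS)
  body-ctx : R ∷ᶜ tail E₁ ~E E₁
  body-ctx = ~E-trans (∷ᶜ-cong (e'' zero ◅◅ ≡⇒~ (++-identityʳ (E₁ zero))) ~E-refl) (∷ᶜ-η E₁)

σ₃-expand : {u : Tm (suc k)} →
            Γ ⊩⟨ n ⟩ app (lam (app (weaken v) u)) t ∶ Q → ∃[ n' ] Γ ⊩⟨ n' ⟩ app v (app (lam u) t) ∶ Q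
σ₃-expand {v = v} (app {Γ₁ = Γ₁} {Γ₂} {P = R} dλ dt e q) with lam-single⁻¹ dλ
... | app {Γ₁ = E₁} {E₂} dwv du e' q' with ⊩-strengthen v dwv
... | E₁' , eS , dv =
  _ , app dv (app (lam-single (⊩-conv-ctx body-ctx du)) dt ~E-refl ε)
        (~E-trans e (~E-trans (⊞-congˡ Γ₂ (λ i → e'' (suc i))) (⊞-assoc E₁' (tail E₂) Γ₂))) (q' ◅◅ q)
  where
  e'' : R ∷ᶜ Γ₁ ~E ([] ∷ᶜ E₁') ⊞ E₂
  e'' = ~E-trans e' (⊞-congˡ E₂ eS)
  body-ctx : R ∷ᶜ tail E₂ ~E E₂
  body-ctx = ~E-trans (∷ᶜ-cong (e'' zero) ~E-refl) (∷ᶜ-η E₂)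

-- A measure decreased by σ-steps

#app : Tm k → ℕ
#app (var i)   = 0
#app (lam t)   = #app t
#app (app t u) = suc (#app t + #app u)

#lam : Tm k → ℕ
#lam (var i)   = 0
#lam (lam t)   = suc (#lam t)
#lam (app t u) = #lam t + #lam u

-- μ t counts the pairs (application, abstraction) of t in which the abstraction does not
-- enclose the application. A σ-step moves an application under an abstraction and keeps
-- #app and #lam, so it decreases μ.
μ : Tm k → ℕ
μ (var i)   = 0
μ (lam t)   = μ t
μ (app t u) = μ t + μ u + #app t * #lam u + #app u * #lam t + (#lam t + #lam u)

#app-rename : (ρ : Fin a → Fin b) (t : Tm a) → #app (rename ρ t) ≡ #app t
#app-rename ρ (var i)   = refl
#app-rename ρ (lam t)   = #app-rename (ext ρ) t
#app-rename ρ (app t u) = ≡.cong₂ (λ x y → suc (x + y)) (#app-rename ρ t) (#app-rename ρ u)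

#lam-rename : (ρ : Fin a → Fin b) (t : Tm a) → #lam (rename ρ t) ≡ #lam t
#lam-rename ρ (var i)   = refl
#lam-rename ρ (lam t)   = ≡.cong suc (#lam-rename (ext ρ) t)
#lam-rename ρ (app t u) = ≡.cong₂ _+_ (#lam-rename ρ t) (#lam-rename ρ u)

μ-rename : (ρ : Fin a → Fin b) (t : Tm a) → μ (rename ρ t) ≡ μ t
μ-rename ρ (var i)   = refl
μ-rename ρ (lam t)   = μ-rename (ext ρ) t
μ-rename ρ (app t u)
  rewrite μ-rename ρ t | μ-rename ρ u | #app-rename ρ t | #app-rename ρ u | #lam-rename ρ t | #lam-rename ρ u
  = refl

infix 4 _≺_

record _≺_ {k : ℕ} (u t : Tm k) : Set where
  field
    μ-<     : μ u < μ t
    #app-≡ : #app u ≡ #app t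
    #lam-≡ : #lam u ≡ #lam t

≺-lam : t' ≺ t → lam t' ≺ lam t
≺-lam r = record { μ-< = μ-< ; #app-≡ = #app-≡ ; #lam-≡ = ≡.cong suc #lam-≡ }
  where open _≺_ r

≺-appˡ : (u : Tm k) → t' ≺ t → app t' u ≺ app t u
≺-appˡ {t' = t'} {t = t} u r = record
  { μ-< = lemma μ-< #app-≡ #lam-≡
  ; #app-≡ = ≡.cong (λ x → suc (x + #app u)) #app-≡
  ; #lam-≡ = ≡.cong (_+ #lam u) #lam-≡
  }
  where
  open _≺_ r
  lemma : μ t' < μ t → #app t' ≡ #app t → #lam t' ≡ #lam t → μ (app t' u) < μ (app t u)
  lemma μ< a l rewrite a | l = +-monoˡ-< _ (+-monoˡ-< _ (+-monoˡ-< _ (+-monoˡ-< (μ u) μ<)))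

≺-appʳ : (t : Tm k) → u' ≺ u → app t u' ≺ app t u
≺-appʳ {u' = u'} {u = u} t r = record
  { μ-< = lemma μ-< #app-≡ #lam-≡
  ; #app-≡ = ≡.cong (λ x → suc (#app t + x)) #app-≡
  ; #lam-≡ = ≡.cong (#lam t +_) #lam-≡
  }
  where
  open _≺_ r
  lemma : μ u' < μ u → #app u' ≡ #app u → #lam u' ≡ #lam u → μ (app t u') < μ (app t u)
  lemma μ< a l rewrite a | l = +-monoˡ-< _ (+-monoˡ-< _ (+-monoˡ-< _ (+-monoʳ-< (μ t) μ<)))

σ₁-μ : (t : Tm (suc k)) (u v : Tm k) →
       μ (app (app (lam t) u) v) ≡ suc (#app v) + μ (app (lam (app t (weaken v))) u)
σ₁-μ t u v rewrite μ-rename suc v | #app-rename suc v | #lam-rename suc v =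
  identity (μ t) (μ u) (μ v) (#app t) (#app u) (#app v) (#lam t) (#lam u) (#lam v)
  where
  identity : ∀ (mt mu mv at au av lt lu lv : ℕ) →
    mt + mu + at * lu + au * suc lt + (suc lt + lu) + mv + suc (at + au) * lv + av * (suc lt + lu) + (suc lt + lu + lv)
    ≡ suc av + (mt + mv + at * lv + av * lt + (lt + lv) + mu + suc (at + av) * lu + au * suc (lt + lv) + (suc (lt + lv) + lu))
  identity = solve-∀

σ₃-μ : (v : Tm k) (u : Tm (suc k)) (t : Tm k) →
       μ (app v (app (lam u) t)) ≡ suc (#app v) + μ (app (lam (app (weaken v) u)) t)
σ₃-μ v u t rewrite μ-rename suc v | #app-rename suc v | #lam-rename suc v =
  identity (μ v) (μ u) (μ t) (#app v) (#app u) (#app t) (#lam v) (#lam u) (#lam t)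
  where
  identity : ∀ (mv mu mt av au at lv lu lt : ℕ) →
    mv + (mu + mt + au * lt + at * suc lu + (suc lu + lt)) + av * (suc lu + lt) + suc (au + at) * lv + (lv + (suc lu + lt))
    ≡ suc av + (mv + mu + av * lu + au * lv + (lv + lu) + mt + suc (av + au) * lt + at * suc (lv + lu) + (suc (lv + lu) + lt))
  identity = solve-∀

σ₁-≺ : (t : Tm (suc k)) (u v : Tm k) → app (lam (app t (weaken v))) u ≺ app (app (lam t) u) v
σ₁-≺ t u v = record
  { μ-<    = ≡.subst (μ (app (lam (app t (weaken v))) u) <_) (≡.sym (σ₁-μ t u v)) (m<n+m _ {suc (#app v)} z<s)
  ; #app-≡ = ≡.cong (λ x → suc (suc x))
               (≡.trans (≡.cong (λ x → #app t + x + #app u) (#app-rename suc v)) (xy∙z≈xz∙y (#app t) (#app v) (#app u)))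
  ; #lam-≡ = ≡.cong suc
               (≡.trans (≡.cong (λ x → #lam t + x + #lam u) (#lam-rename suc v)) (xy∙z≈xz∙y (#lam t) (#lam v) (#lam u)))
  }

σ₃-≺ : (v : Tm k) (u : Tm (suc k)) (t : Tm k) → app (lam (app (weaken v) u)) t ≺ app v (app (lam u) t)
σ₃-≺ v u t = record
  { μ-<    = ≡.subst (μ (app (lam (app (weaken v) u)) t) <_) (≡.sym (σ₃-μ v u t)) (m<n+m _ {suc (#app v)} z<s)
  ; #app-≡ = ≡.cong suc
               (≡.trans (≡.cong (λ x → suc (x + #app u + #app t)) (#app-rename suc v))
                        (≡.trans (≡.cong suc (+-assoc (#app v) (#app u) (#app t))) (≡.sym (+-suc (#app v) _))))
  ; #lam-≡ = ≡.trans (≡.cong (λ x → suc (x + #lam u + #lam t)) (#lam-rename suc v))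
               (≡.trans (≡.cong suc (+-assoc (#lam v) (#lam u) (#lam t))) (≡.sym (+-suc (#lam v) _)))
  }

data Descent {k : ℕ} : ℕ → Tm k → ℕ → Tm k → Set where
  smaller : n < m → Descent n u m t
  flatter : u ≺ t → Descent n u n t

descent-lam : {t t' : Tm (suc k)} → Descent n t' m t → Descent n (lam t') m (lam t)
descent-lam (smaller n<m) = smaller n<m
descent-lam (flatter r)   = flatter (≺-lam r)

descent-appˡ : ∀ {p} (u : Tm k) → Descent n t' m t → Descent (suc (n + p)) (app t' u) (suc (m + p)) (app t u)
descent-appˡ u (smaller n<m) = smaller (s<s (+-monoˡ-< _ n<m))
descent-appˡ u (flatter r)   = flatter (≺-appˡ u r)

descent-appʳ : ∀ {p} (t : Tm k) → Descent n u' m u → Descent (suc (p + n)) (app t u') (suc (p + m)) (app t u)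
descent-appʳ t (smaller n<m) = smaller (s<s (+-monoʳ-< _ n<m))
descent-appʳ t (flatter r)   = flatter (≺-appʳ t r)

root-reduce : t ↦sh u → Γ ⊩⟨ n ⟩ t ∶ Q → ∃[ n' ] (Descent n' u n t × Γ ⊩⟨ n' ⟩ u ∶ Q)
root-reduce (βv (βv t v vv)) d@(app _ _ _ _) = _ , smaller (n<1+n _) , βv-reduce vv d
root-reduce (σ (σ₁ t u v))    d = _ , flatter (σ₁-≺ t u v) , σ₁-reduce d
root-reduce (σ (σ₃ v u t vv)) d = _ , flatter (σ₃-≺ v u t) , σ₃-reduce d

root-expand : t ↦sh u → Γ ⊩⟨ n ⟩ u ∶ Q → ∃[ n' ] Γ ⊩⟨ n' ⟩ t ∶ Q
root-expand (βv (βv t v vv)) d = βv-expand vv d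
root-expand (σ (σ₁ t u v))    d = σ₁-expand d
root-expand (σ (σ₃ v u t vv)) d = σ₃-expand d

⊩-reduceᵇ : t →bsh u → Γ ⊩⟨ n ⟩ t ∶ Q → ∃[ n' ] (Descent n' u n t × Γ ⊩⟨ n' ⟩ u ∶ Q)
⊩-reduceᵇ (root r) d = root-reduce r d
⊩-reduceᵇ (lamApp {s = u} st) (app dλ du e q) with ⊩-reduceᵇ st (lam-single⁻¹ dλ)
... | _ , δ , d' = _ , descent-appˡ u (descent-lam δ) , app (lam-single d') du e q
⊩-reduceᵇ (appL {s = u} st) (app d₁ d₂ e q) with ⊩-reduceᵇ st d₁
... | _ , δ , d₁' = _ , descent-appˡ u δ , app d₁' d₂ e q
⊩-reduceᵇ (appR {t = t} st) (app d₁ d₂ e q) with ⊩-reduceᵇ st d₂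
... | _ , δ , d₂' = _ , descent-appʳ t δ , app d₁ d₂' e q

⊩Λ-map : {t u : Tm (suc k)} → (∀ {Γ' : Ctx (suc k)} {n Q} → Γ' ⊩⟨ n ⟩ t ∶ Q → ∃[ n' ] Γ' ⊩⟨ n' ⟩ u ∶ Q) →
         Γ ⊩Λ⟨ n ⟩ t ∶ A → ∃[ n' ] Γ ⊩Λ⟨ n' ⟩ u ∶ A
⊩Λ-map f (nil e) = _ , nil e
⊩Λ-map f (cons d l e) with f d | ⊩Λ-map f l
... | _ , d' | _ , l' = _ , cons d' l' e

⊩-reduce : t →sh u → Γ ⊩⟨ n ⟩ t ∶ Q → ∃[ n' ] Γ ⊩⟨ n' ⟩ u ∶ Q
⊩-reduce (root r) d with root-reduce r d
... | _ , _ , d' = _ , d'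
⊩-reduce (lam st) (lam l q) with ⊩Λ-map (⊩-reduce st) l
... | _ , l' = _ , lam l' q
⊩-reduce (appL st) (app d₁ d₂ e q) with ⊩-reduce st d₁
... | _ , d₁' = _ , app d₁' d₂ e q
⊩-reduce (appR st) (app d₁ d₂ e q) with ⊩-reduce st d₂
... | _ , d₂' = _ , app d₁ d₂' e q

⊩-expand : t →sh u → Γ ⊩⟨ n ⟩ u ∶ Q → ∃[ n' ] Γ ⊩⟨ n' ⟩ t ∶ Q
⊩-expand (root r) d = root-expand r d
⊩-expand (lam st) (lam l q) with ⊩Λ-map (⊩-expand st) l
... | _ , l' = _ , lam l' q
⊩-expand (appL st) (app d₁ d₂ e q) with ⊩-expand st d₁
... | _ , d₁' = _ , app d₁' d₂ e q
⊩-expand (appR st) (app d₁ d₂ e q) with ⊩-expand st d₂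
... | _ , d₂' = _ , app d₁ d₂' e q

-- Strong normalisation

_<ₗₑₓ_ : ℕ × ℕ → ℕ × ℕ → Set
_<ₗₑₓ_ = ×-Lex _≡_ _<_ _<_

⊩⇒SN : Γ ⊩⟨ n ⟩ t ∶ Q → BshSN t
⊩⇒SN {n = n} {t = t} = go (×-wellFounded <-wellFounded <-wellFounded (n , μ t))
  where
  go : ∀ {k n} {Γ : Ctx k} {t Q} → Acc _<ₗₑₓ_ (n , μ t) → Γ ⊩⟨ n ⟩ t ∶ Q → BshSN t
  go (acc rec) d = acc λ st → case ⊩-reduceᵇ st d of λ where
    (_ , smaller n'<n , d') → go (rec (inj₁ n'<n)) d'
    (_ , flatter r    , d') → go (rec (inj₂ (refl , _≺_.μ-< r))) d'

-- Normal forms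

Reducible : Tm k → Set
Reducible t = ∃[ u ] t →bsh u

-- lamApp is the only balanced rule that reduces inside an abstraction.
BodyNormal : Tm k → Set
BodyNormal (lam t) = BshNormal t
BodyNormal _       = ⊤

root? : (t u : Tm k) → (∃[ s ] app t u ↦sh s) ⊎ (∀ s → ¬ app t u ↦sh s)
root? (app (lam t) u)     s                 = inj₁ (_ , σ (σ₁ t u s))
root? (var i)             (app (lam s) u)   = inj₁ (_ , σ (σ₃ (var i) s u (var i)))
root? (lam t)             (app (lam s) u)   = inj₁ (_ , σ (σ₃ (lam t) s u (lam t)))
root? (lam t)             (var i)           = inj₁ (_ , βv (βv t (var i) (var i)))
root? (lam t)             (lam s)           = inj₁ (_ , βv (βv t (lam s) (lam s)))
root? (lam t)             (app (var i) u)   = inj₂ λ { _ (βv (βv _ _ ())) }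
root? (lam t)             (app (app _ _) u) = inj₂ λ { _ (βv (βv _ _ ())) }
root? (var i)             (var j)           = inj₂ λ { _ (βv ()) ; _ (σ ()) }
root? (var i)             (lam s)           = inj₂ λ { _ (βv ()) ; _ (σ ()) }
root? (var i)             (app (var j) u)   = inj₂ λ { _ (βv ()) ; _ (σ ()) }
root? (var i)             (app (app _ _) u) = inj₂ λ { _ (βv ()) ; _ (σ ()) }
root? (app (var i) t)     s                 = inj₂ λ { _ (βv ()) ; _ (σ (σ₃ _ _ _ ())) }
root? (app (app _ _) t)   s                 = inj₂ λ { _ (βv ()) ; _ (σ (σ₃ _ _ _ ())) }

value-normal : Value v → BshNormal v
value-normal (var i) _ (root (βv ()))
value-normal (var i) _ (root (σ ()))
value-normal (lam t) _ (root (βv ()))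
value-normal (lam t) _ (root (σ ()))

app-normal : BshNormal t → BshNormal u → (∀ s → ¬ app t u ↦sh s) → BodyNormal t → BshNormal (app t u)
app-normal nt nu nr nb _ (root r)    = nr _ r
app-normal nt nu nr nb _ (lamApp st) = nb _ st
app-normal nt nu nr nb _ (appL st)   = nt _ st
app-normal nt nu nr nb _ (appR st)   = nu _ st

mutual
  progress : (t : Tm k) → Reducible t ⊎ BshNormal t
  progress (var i)   = inj₂ (value-normal (var i))
  progress (lam t)   = inj₂ (value-normal (lam t))
  progress (app t u) with progress t | progress u | root? t u | body-progress t u
  ... | inj₁ (_ , st) | _             | _            | _             = inj₁ (_ , appL st)
  ... | inj₂ _        | inj₁ (_ , st) | _            | _             = inj₁ (_ , appR st)
  ... | inj₂ _        | inj₂ _        | inj₁ (_ , r) | _             = inj₁ (_ , root r)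
  ... | inj₂ _        | inj₂ _        | inj₂ _       | inj₁ red      = inj₁ red
  ... | inj₂ nt       | inj₂ nu       | inj₂ nr      | inj₂ nb       = inj₂ (app-normal nt nu nr nb)

  body-progress : (t u : Tm k) → Reducible (app t u) ⊎ BodyNormal t
  body-progress (lam t) u with progress t
  ... | inj₁ (_ , st) = inj₁ (_ , lamApp st)
  ... | inj₂ nt       = inj₂ nt
  body-progress (var i)   u = inj₂ tt
  body-progress (app _ _) u = inj₂ tt

SN⇒normalizable : BshSN t → BshNormalizable t
SN⇒normalizable {t = t} (acc rs) with progress t
... | inj₂ nf = t , ε , nf
... | inj₁ (u , st) with SN⇒normalizable (rs st)
...   | w , steps , nf = w , st ◅ steps , nf

NotAbs : Tm k → Set
NotAbs (lam _) = ⊥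
NotAbs _       = ⊤

normal-appˡ : BshNormal (app t u) → BshNormal t
normal-appˡ nf _ st = nf _ (appL st)

normal-appʳ : BshNormal (app t u) → BshNormal u
normal-appʳ nf _ st = nf _ (appR st)

normal-body : {t : Tm (suc k)} → BshNormal (app (lam t) u) → BshNormal t
normal-body nf _ st = nf _ (lamApp st)

σ₁-free : (t : Tm k) → BshNormal (app (app t u) v) → NotAbs t
σ₁-free (lam t)   nf = nf _ (root (σ (σ₁ t _ _)))
σ₁-free (var i)   nf = tt
σ₁-free (app _ _) nf = tt

σ₃-free : {t : Tm (suc k)} (u : Tm k) → BshNormal (app (lam t) (app u v)) → NotAbs u
σ₃-free {t = t} (lam u) nf = nf _ (root (σ (σ₃ (lam t) u _ (lam t))))
σ₃-free (var i)   nf = tt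
σ₃-free (app _ _) nf = tt

HasType : Tm k → Pos → Set
HasType t Q = ∃[ Γ ] ∃[ n ] Γ ⊩⟨ n ⟩ t ∶ Q

-- A normal application whose head is not an abstraction is a variable applied to normal
-- arguments, so it has every type: type the arguments with [] and the variable accordingly.
mutual
  normal-typable : (t : Tm k) → BshNormal t → HasType t []
  normal-typable (var i)   nf = i ↦ [] , 0 , ax i ~E-refl
  normal-typable (lam t)   nf = ∅ , 0 , lam (nil ~E-refl) ε
  normal-typable (app (var i) u)     nf = neutral-typable (var i) u tt nf []
  normal-typable (app (app t₁ t₂) u) nf = neutral-typable (app t₁ t₂) u tt nf []
  normal-typable (app (lam t) (var i)) nf = ⊥-elim (nf _ (root (βv (βv t (var i) (var i)))))
  normal-typable (app (lam t) (lam u)) nf = ⊥-elim (nf _ (root (βv (βv t (lam u) (lam u)))))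
  normal-typable (app (lam t) (app u₁ u₂)) nf with normal-typable t (normal-body nf)
  ... | Γ , _ , d with neutral-typable u₁ u₂ (σ₃-free u₁ nf) (normal-appʳ nf) (Γ zero)
  ...   | Δ , _ , du = _ , _ , app (lam-single (⊩-conv-ctx (∷ᶜ-η Γ) d)) du ~E-refl ε

  neutral-typable : (t u : Tm k) → NotAbs t → BshNormal (app t u) → ∀ Q → HasType (app t u) Q
  neutral-typable (var i) u _ nf Q with normal-typable u (normal-appʳ nf)
  ... | Δ , _ , du = _ , _ , app (ax i {(([] ⊸ Q) ∷ [])} ~E-refl) du ~E-refl ε
  neutral-typable (app t₁ t₂) u _ nf Q
    with neutral-typable t₁ t₂ (σ₁-free t₁ nf) (normal-appˡ nf) (([] ⊸ Q) ∷ [])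
       | normal-typable u (normal-appʳ nf)
  ... | Γ , _ , d | Δ , _ , du = _ , _ , app d du ~E-refl ε

-- Comparison with _⊢_∶_

lookup-single : (i : Fin k) (P : Pos) (j : Fin k) → Vec.lookup (single i P) j ≡ (i ↦ P) j
lookup-single zero    P zero    = refl
lookup-single zero    P (suc j) = Vecₚ.lookup-replicate j []
lookup-single (suc i) P zero    = refl
lookup-single (suc i) P (suc j) = lookup-single i P j

lookup-⊕ : (E E' : Env k) (j : Fin k) → Vec.lookup (E ⊕ E') j ≡ Vec.lookup E j ++ Vec.lookup E' j
lookup-⊕ E E' j = Vecₚ.lookup-zipWith _++_ j E E'

~⇒≈E* : (E E' : Env k) → (∀ j → Vec.lookup E j ~ Vec.lookup E' j) → Star _≈E_ E E'
~⇒≈E* []      []        e = ε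
~⇒≈E* (P ∷ E) (P' ∷ E') e =
  Star.gmap (_∷ E) (λ p → λ { zero → p ; (suc j) → ≈P-refl _ }) (e zero) ◅◅
  Star.gmap (P' ∷_) (λ f → λ { zero → ≈P-refl P' ; (suc j) → f j }) (~⇒≈E* E E' (λ j → e (suc j)))

⊢-conv : {E E' : Env k} → (∀ j → Vec.lookup E j ~ Vec.lookup E' j) → Q ~ Q' → E ⊢ t ∶ Q → E' ⊢ t ∶ Q'
⊢-conv {E = E} {E'} e q d = along-type q (along-env (~⇒≈E* E E' e) d)
  where
  along-env : ∀ {E E'} → Star _≈E_ E E' → E ⊢ t ∶ Q → E' ⊢ t ∶ Q
  along-env ε        d = d
  along-env (s ◅ ss) d = along-env ss (conv d s (≈P-refl _))
  along-type : ∀ {Q Q'} → Q ~ Q' → E' ⊢ t ∶ Q → E' ⊢ t ∶ Q'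
  along-type ε        d = d
  along-type (s ◅ ss) d = along-type ss (conv d (λ j → ≈P-refl _) s)

mutual
  ⊢⇒⊩ : {E : Env k} → E ⊢ t ∶ Q → ∃[ n ] Vec.lookup E ⊩⟨ n ⟩ t ∶ Q
  ⊢⇒⊩ (ax i P) = 0 , ax i (λ j → ≡⇒~ (lookup-single i P j))
  ⊢⇒⊩ (app {Γ = E₁} {E₂} d₁ d₂) with ⊢⇒⊩ d₁ | ⊢⇒⊩ d₂
  ... | _ , d₁' | _ , d₂' = _ , app d₁' d₂' (λ j → ≡⇒~ (lookup-⊕ E₁ E₂ j)) ε
  ⊢⇒⊩ (lam ps) with LamPremises⇒⊩Λ ps
  ... | _ , l = _ , lam l ε
  ⊢⇒⊩ (conv d e p) with ⊢⇒⊩ d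
  ... | _ , d' = _ , ⊩-conv (λ j → ≈P-sym (e j)) (p ◅ ε) d'

  LamPremises⇒⊩Λ : {E : Env k} {t : Tm (suc k)} → LamPremises E t A → ∃[ n ] Vec.lookup E ⊩Λ⟨ n ⟩ t ∶ A
  LamPremises⇒⊩Λ [] = 0 , nil (λ j → ≡⇒~ (Vecₚ.lookup-replicate j []))
  LamPremises⇒⊩Λ (_∷_ {Γ = E₁} {E₂} d ps) with ⊢⇒⊩ d | LamPremises⇒⊩Λ ps
  ... | _ , d' | _ , l =
    _ , cons (⊩-conv-ctx (λ { zero → ε ; (suc j) → ε }) d') l (λ j → ≡⇒~ (lookup-⊕ E₁ E₂ j))

lookup-tabulate-~ : (Γ : Ctx k) (j : Fin k) → Vec.lookup (Vec.tabulate Γ) j ~ Γ j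
lookup-tabulate-~ Γ j = ≡⇒~ (Vecₚ.lookup∘tabulate Γ j)

mutual
  ⊩⇒⊢ : Γ ⊩⟨ n ⟩ t ∶ Q → Vec.tabulate Γ ⊢ t ∶ Q
  ⊩⇒⊢ {Γ = Γ} (ax i {P} e) =
    ⊢-conv (λ j → ≡⇒~ (lookup-single i P j) ◅◅ ~-sym (e j) ◅◅ ~-sym (lookup-tabulate-~ Γ j)) ε (ax i P)
  ⊩⇒⊢ {Γ = Γ} (app {Γ₁ = Γ₁} {Γ₂} d₁ d₂ e q) =
    ⊢-conv (λ j → ≡⇒~ (lookup-⊕ (Vec.tabulate Γ₁) (Vec.tabulate Γ₂) j)
                  ◅◅ ++-cong (lookup-tabulate-~ Γ₁ j) (lookup-tabulate-~ Γ₂ j)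
                  ◅◅ ~-sym (e j) ◅◅ ~-sym (lookup-tabulate-~ Γ j))
           q (app (⊩⇒⊢ d₁) (⊩⇒⊢ d₂))
  ⊩⇒⊢ {Γ = Γ} (lam l q) with ⊩Λ⇒LamPremises l
  ... | _ , ps , f = ⊢-conv (λ j → f j ◅◅ ~-sym (lookup-tabulate-~ Γ j)) q (lam ps)

  ⊩Λ⇒LamPremises : {t : Tm (suc k)} → Γ ⊩Λ⟨ n ⟩ t ∶ A →
                   ∃[ E ] (LamPremises E t A × (∀ j → Vec.lookup E j ~ Γ j))
  ⊩Λ⇒LamPremises (nil e) = _ , [] , (λ j → ≡⇒~ (Vecₚ.lookup-replicate j []) ◅◅ ~-sym (e j))
  ⊩Λ⇒LamPremises (cons {Γ₁ = Γ₁} d l e) with ⊩Λ⇒LamPremises l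
  ... | E , ps , f =
    _ , ⊩⇒⊢ d ∷ ps ,
    (λ j → ≡⇒~ (lookup-⊕ (Vec.tabulate Γ₁) E j) ◅◅ ++-cong (lookup-tabulate-~ Γ₁ j) (f j) ◅◅ ~-sym (e j))

-- Typability and normalisation

bsh⇒sh : t →bsh u → t →sh u
bsh⇒sh (root r)    = root r
bsh⇒sh (lamApp st) = appL (lam (bsh⇒sh st))
bsh⇒sh (appL st)   = appL (bsh⇒sh st)
bsh⇒sh (appR st)   = appR (bsh⇒sh st)

Typable : Tm k → Set
Typable t = ∃[ Q ] HasType t Q

⊩-along-≃ : t ≃sh u → Γ ⊩⟨ n ⟩ u ∶ Q → ∃[ n' ] Γ ⊩⟨ n' ⟩ t ∶ Q
⊩-along-≃ ε            d = _ , d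
⊩-along-≃ (fwd st ◅ c) d with ⊩-along-≃ c d
... | _ , d' = ⊩-expand st d'
⊩-along-≃ (bwd st ◅ c) d with ⊩-along-≃ c d
... | _ , d' = ⊩-reduce st d'

normalizable⇒≃-normal : BshNormalizable t → ∃[ u ] (t ≃sh u × BshNormal u)
normalizable⇒≃-normal (u , steps , nf) = u , Star.map (fwd ∘ bsh⇒sh) steps , nf

≃-normal⇒typable : ∃[ u ] (t ≃sh u × BshNormal u) → Typable t
≃-normal⇒typable (u , t≃u , nf) with normal-typable u nf
... | Γ , _ , d = [] , Γ , ⊩-along-≃ t≃u d

normalizable⇒typable : BshNormalizable t → Typable t
normalizable⇒typable = ≃-normal⇒typable ∘ normalizable⇒≃-normal

typable⇒SN : Typable t → BshSN t
typable⇒SN (_ , _ , _ , d) = ⊩⇒SN d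

typable⇒normalizable : Typable t → BshNormalizable t
typable⇒normalizable = SN⇒normalizable ∘ typable⇒SN

typable⇒⟦⟧ : Typable t → Satisfiable ⟦ t ⟧
typable⇒⟦⟧ (Q , Γ , _ , d) = (Vec.tabulate Γ , Q) , ⊩⇒⊢ d

⟦⟧⇒typable : Satisfiable ⟦ t ⟧ → Typable t
⟦⟧⇒typable ((E , Q) , d) = Q , Vec.lookup E , ⊢⇒⊩ d

typable⇒⊢ : {t : Tm k} → Typable t → Σ (Vec Pos k) λ Ps → Σ Pos λ Q → Ps ⊢ t ∶ Q
typable⇒⊢ (Q , Γ , _ , d) = Vec.tabulate Γ , Q , ⊩⇒⊢ d

⊢⇒typable : {t : Tm k} → (Σ (Vec Pos k) λ Ps → Σ Pos λ Q → Ps ⊢ t ∶ Q) → Typable t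
⊢⇒typable (E , Q , d) = Q , Vec.lookup E , ⊢⇒⊩ d

theorem4p4 : {k : ℕ} (t : Tm k) →
    (BshNormalizable t ⇔ (∃ λ u → t ≃sh u × BshNormal u))
    × (BshNormalizable t ⇔ Satisfiable ⟦ t ⟧)
    × (BshNormalizable t ⇔ (Σ (Vec Pos k) λ Ps → Σ Pos λ Q → Ps ⊢ t ∶ Q))
    × (BshNormalizable t ⇔ BshSN t)
theorem4p4 t =
    mk⇔ normalizable⇒≃-normal (typable⇒normalizable ∘ ≃-normal⇒typable)
  , mk⇔ (typable⇒⟦⟧ ∘ normalizable⇒typable) (typable⇒normalizable ∘ ⟦⟧⇒typable)
  , mk⇔ (typable⇒⊢ ∘ normalizable⇒typable) (typable⇒normalizable ∘ ⊢⇒typable)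
  , mk⇔ (typable⇒SN ∘ normalizable⇒typable) SN⇒normalizable
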